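{- Let $\lambda$ be a partition (straight shape) of Frobenius rank $k$. Then $\sum (-1)^{c(\mathcal{I})}x^{(\mathcal{I},\alpha)}=0$ (as a formal power series in $x_1,x_2,\ldots$), where the sum ranges over all labelled interval sets $(\mathcal{I},\alpha)$ of $\lambda$ in which at least one label is repeated.
   Context: Young diagram $\lambda=\{(i,j):1\le j\le\lambda_i\}$; $\mathrm{rank}(\lambda)$ is the largest $i$ with $\lambda_i\ge i$. Edges of the lower envelope: unit edges that are the lower or right-hand edge of some square of $\lambda$ but not the upper or left-hand edge of any square of $\lambda$, ordered from lower left to upper right. Snake of such an edge $e$: if $e$ is horizontal and is the lower edge of $(i,j)\in\lambda$, $S_e=\lambda\cap\{(i,j),(i,j-1),(i-1,j-1),(i-1,j-2),(i-2,j-2),\ldots\}$; if $e$ is vertical and is the right-hand edge of $(i,j)\in\lambda$, $S_e=\lambda\cap\{(i,j),(i-1,j),(i-1,j-1),(i-2,j-1),\ldots\}$. Its length is its number of squares minus one. The snake sequence $\mathrm{SS}(\lambda)=q_1q_2\cdots q_m$ records, in order, $L$ for an even-length snake of a horizontal edge, $R$ for an even-length snake of a vertical edge, and $O$ for an odd-length snake. An interval set of $\lambda$ is a set $\mathcal{I}=\{(u_1,v_1),\ldots,(u_k,v_k)\}$ of $k$ pairs with all $u_i,v_i$ distinct integers, $1\le u_i<v_i\le m$, $q_{u_i}=L$ and $q_{v_i}=R$. Its crossing number $c(\mathcal{I})$ is the number of pairs $(i,j)$ with $u_i<u_j<v_i<v_j$. A labelled interval set is an interval set together with a labelling assigning to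 each interval $(u_i,v_i)$ a positive integer $\alpha_i$; it has a repeated label if $\alpha_i=\alpha_j$ for some $i\ne j$. Set $x^{(\mathcal{I},\alpha)}=\prod_{i=1}^k x_{\alpha_i}^{v_i-u_i}$. -}

module Defs where

open import Data.Nat using (ℕ; zero; suc; _+_; _∸_; _⊔_; _≤_; _>_; _≤ᵇ_; _≡ᵇ_)
open import Data.Bool using (Bool; true; false; _∧_; _∨_; not; if_then_else_)
open import Data.List using (List; []; _∷_; map; upTo; length; filter; foldr; concatMap; reverse; _∷ʳ_; _++_)
open import Data.Bool.ListAction using (any; all)
open import Data.List.Relation.Unary.All using (All)
open import Data.List.Relation.Unary.Linked using (Linked)
open import Data.Product using (_×_; _,_; proj₁; proj₂)
open import Data.Maybe using (Maybe; just; nothing)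
open import Data.Integer using (ℤ; 0ℤ; 1ℤ; -_) renaming (_+_ to _+ℤ_; _^_ to _^ℤ_)
open import Relation.Nullary.Decidable using (T?)

IsPartition : List ℕ → Set
IsPartition λ′ = Linked (λ a b → b ≤ a) λ′ × All (λ a → a > 0) λ′

-- 1-indexed lookup, 0 outside the range: row λ i = λ_i.
row : List ℕ → ℕ → ℕ
row _ zero = 0
row [] (suc _) = 0
row (x ∷ _) (suc zero) = x
row (_ ∷ xs) (suc (suc i)) = row xs (suc i)

oneTo : ℕ → List ℕ
oneTo n = map suc (upTo n)

inDiagram : List ℕ → ℕ × ℕ → Bool
inDiagram λ′ (i , j) = (1 ≤ᵇ i) ∧ (1 ≤ᵇ j) ∧ (j ≤ᵇ row λ′ i)

rank : List ℕ → ℕ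
rank λ′ = foldr _⊔_ 0 (Data.List.filterᵇ (λ i → i ≤ᵇ row λ′ i) (oneTo (length λ′)))

-- Edges of the lower envelope (English convention: row i lies below row i-1).
-- hor i j = lower edge of square (i , j);  ver i j = right-hand edge of (i , j).

data Edge : Set where
  hor ver : ℕ → ℕ → Edge

-- Edges contributed by row i, from left to right: the lower edges of
-- (i , j) for λ_{i+1} < j ≤ λ_i, followed by the right edge of (i , λ_i).
envRow : List ℕ → ℕ → List Edge
envRow λ′ i =
  map (λ t → hor i (suc (row λ′ (suc i) + t))) (upTo (row λ′ i ∸ row λ′ (suc i)))
  ∷ʳ ver i (row λ′ i)

-- The lower envelope, ordered from lower left to upper right
-- (rows ℓ, ℓ-1, …, 1).
envelope : List ℕ → List Edge
envelope λ′ = concatMap (envRow λ′) (reverse (oneTo (length λ′)))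

-- Snakes.  leftFirst i j  lists (i,j),(i,j-1),(i-1,j-1),(i-1,j-2),…
--          upFirst   i j  lists (i,j),(i-1,j),(i-1,j-1),(i-2,j-1),…
-- (truncated once a coordinate reaches 0: all later squares lie outside λ).

mutual
  leftFirst : ℕ → ℕ → List (ℕ × ℕ)
  leftFirst i zero = []
  leftFirst i (suc j) = (i , suc j) ∷ upFirst i j

  upFirst : ℕ → ℕ → List (ℕ × ℕ)
  upFirst zero j = []
  upFirst (suc i) j = (suc i , j) ∷ leftFirst i j

snake : List ℕ → Edge → List (ℕ × ℕ)
snake λ′ (hor i j) = Data.List.filterᵇ (inDiagram λ′) (leftFirst i j)
snake λ′ (ver i j) = Data.List.filterᵇ (inDiagram λ′) (upFirst i j)

snakeLength : List ℕ → Edge → ℕ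
snakeLength λ′ e = length (snake λ′ e) ∸ 1

evenᵇ : ℕ → Bool
evenᵇ zero = true
evenᵇ (suc n) = not (evenᵇ n)

data Letter : Set where
  L R O : Letter

letter : List ℕ → Edge → Letter
letter λ′ e@(hor _ _) = if evenᵇ (snakeLength λ′ e) then L else O
letter λ′ e@(ver _ _) = if evenᵇ (snakeLength λ′ e) then R else O

SS : List ℕ → List Letter
SS λ′ = map (letter λ′) (envelope λ′)

-- A labelled interval set (a set of
-- intervals) is represented canonically by the list of its intervals
-- sorted by strictly increasing left endpoint u.

LInt : Set
LInt = ℕ × ℕ × ℕ

lu lv lab : LInt → ℕ
lu (u , _ , _) = u
lv (_ , v , _) = v
lab (_ , _ , a) = a

isL isR : Maybe Letter → Bool
isL (just L) = true
isL _ = false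
isR (just R) = true
isR _ = false

-- q_u  (1-indexed)
qAt : List Letter → ℕ → Maybe Letter
qAt _ zero = nothing
qAt [] (suc _) = nothing
qAt (x ∷ _) (suc zero) = just x
qAt (_ ∷ xs) (suc (suc n)) = qAt xs (suc n)

elemᵇ : ℕ → List ℕ → Bool
elemᵇ x = any (x ≡ᵇ_)

distinctᵇ : List ℕ → Bool
distinctᵇ [] = true
distinctᵇ (x ∷ xs) = not (elemᵇ x xs) ∧ distinctᵇ xs

increasingᵇ : List ℕ → Bool
increasingᵇ [] = true
increasingᵇ (x ∷ []) = true
increasingᵇ (x ∷ y ∷ xs) = (suc x ≤ᵇ y) ∧ increasingᵇ (y ∷ xs)

isIntervalSetᵇ : List ℕ → ℕ → List LInt → Bool
isIntervalSetᵇ λ′ k ι =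
  (length ι ≡ᵇ k)
  ∧ increasingᵇ (map lu ι)
  ∧ distinctᵇ (map lu ι ++ map lv ι)
  ∧ all (λ t → (1 ≤ᵇ lu t) ∧ (suc (lu t) ≤ᵇ lv t) ∧ (lv t ≤ᵇ length (SS λ′))
               ∧ isL (qAt (SS λ′) (lu t)) ∧ isR (qAt (SS λ′) (lv t))) ι

positiveLabelsᵇ : List LInt → Bool
positiveLabelsᵇ ι = all (λ t → 1 ≤ᵇ lab t) ι

repeatedLabelᵇ : List LInt → Bool
repeatedLabelᵇ ι = not (distinctᵇ (map lab ι))

crossing : List LInt → ℕ
crossing ι = length (Data.List.filterᵇ
  (λ p → (suc (lu (proj₁ p)) ≤ᵇ lu (proj₂ p)) ∧ (suc (lu (proj₂ p)) ≤ᵇ lv (proj₁ p))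
         ∧ (suc (lv (proj₁ p)) ≤ᵇ lv (proj₂ p)))
  (Data.List.cartesianProduct ι ι))

-- exponent of x_a in x^(ι) = ∏ x_{α_i}^{v_i - u_i}
exponent : List LInt → ℕ → ℕ
exponent ι a = foldr _+_ 0 (map (λ t → lv t ∸ lu t) (Data.List.filterᵇ (λ t → lab t ≡ᵇ a) ι))

-- x^(ι) = x^β, where β = (β₁,…,β_N) lists the exponents of x₁,…,x_N
-- (all other variables having exponent 0).
monomialIsᵇ : List ℕ → List LInt → Bool
monomialIsᵇ β ι = all (λ a → exponent ι a ≡ᵇ row β a) (oneTo (length β))
                  ∧ all (λ t → lab t ≤ᵇ length β) ι

listsOfLength : {A : Set} → ℕ → List A → List (List A)
listsOfLength zero xs = [] ∷ []
listsOfLength (suc k) xs = concatMap (λ x → map (x ∷_) (listsOfLength k xs)) xs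

triples : ℕ → ℕ → List LInt
triples m N = concatMap (λ u → concatMap (λ v → map (λ a → (u , v , a)) (oneTo N)) (oneTo m)) (oneTo m)

sign : ℕ → ℤ
sign c = (- 1ℤ) ^ℤ c

sumℤ : List ℤ → ℤ
sumℤ = foldr _+ℤ_ 0ℤ

-- Labelled sets with a label a > N = length β contribute only to monomials
-- involving x_a, so only labels in [1..N] need to be enumerated.
coeffRepeated : List ℕ → List ℕ → ℤ
coeffRepeated λ′ β =
  sumℤ (map (λ ι → sign (crossing ι))
    (Data.List.filterᵇ
      (λ ι → isIntervalSetᵇ λ′ (rank λ′) ι ∧ positiveLabelsᵇ ι
             ∧ repeatedLabelᵇ ι ∧ monomialIsᵇ β ι)
      (listsOfLength (rank λ′) (triples (length (SS λ′)) (length β)))))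

module Submission where

-- The terms cancel in pairs under the involution `switch`: the first interval whose label occurs
-- again exchanges its right endpoint with the next interval carrying that label. In SS(λ) every L
-- precedes every R: the snake of the lower edge of a square (i, j) has even length iff j ≤ i, that
-- of its right edge iff i ≤ j, and an R closing row i forces λᵢ ≥ i, which puts every horizontal
-- edge of the rows above strictly right of the diagonal. So every left endpoint lies below every
-- right endpoint; the exchange therefore keeps the interval set valid and the monomial unchanged,
-- as (v₁ - u₁) + (v₂ - u₂) = (v₂ - u₁) + (v₁ - u₂). It flips the parity of the crossing number:
-- the exchanged pair switches between nested and crossing, while any other interval crosses the
-- pair equally often modulo 2 before and after.

open import Defs
open import Data.Bool using (Bool; true; false; T; not; _∧_; _xor_; if_then_else_)
open import Data.Bool.Properties using (T-∧; xor-assoc; not-distribˡ-xor; not-distribʳ-xor)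
open import Data.Bool.Solver using (module xor-∧-Solver)
open import Data.Empty using (⊥-elim)
open import Data.Integer using (ℤ; 0ℤ; 1ℤ; -_; +_; -[1+_]) renaming (_+_ to _+ℤ_)
open import Data.Integer.Properties using (+-0-isCommutativeMonoid; neg-distrib-+)
open import Data.List
  using (List; []; _∷_; map; length; _++_; foldr; filterᵇ; cartesianProduct; upTo; downFrom; concatMap; reverse)
open import Data.List.Properties
  using (map-∘; map-cong-local; map-++; ++-assoc; length-map; reverse-map; reverse-upTo; map-concatMap
        ; concatMap-map; ∷-injective; ∷-injectiveˡ)
open import Data.List.Membership.Propositional using (_∈_)
open import Data.List.Membership.Propositional.Properties
  using (∈-map⁺; ∈-map⁻; ∈-++⁻; ∈-upTo⁺; ∈-concatMap⁺; ∈-concatMap⁻; ∈-filter⁺; ∈-filter⁻)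
open import Data.List.Membership.Propositional.Properties.WithK using (unique∧set⇒bag)
open import Data.List.Relation.Binary.BagAndSetEquality using (∼bag⇒↭)
open import Data.List.Relation.Binary.Permutation.Propositional
  using (_↭_; ↭-refl; ↭-sym; ↭-prep; ↭-swap; ↭-reflexive; ↭⇒↭ₛ; module PermutationReasoning)
import Data.List.Relation.Binary.Permutation.Propositional as Perm
open import Data.List.Relation.Binary.Permutation.Propositional.Properties
  using (All-resp-↭; shift; filter-↭) renaming (map⁺ to ↭-map⁺; ++⁺ to ↭-++⁺)
import Data.List.Relation.Binary.Permutation.Setoid.Properties as PermutationSetoid
open import Data.List.Relation.Unary.All as All using (All; []; _∷_)
import Data.List.Relation.Unary.All.Properties as All
open import Data.List.Relation.Unary.AllPairs as AllPairs using (AllPairs; []; _∷_)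
import Data.List.Relation.Unary.AllPairs.Properties as AllPairs
open import Data.List.Relation.Unary.Any as Any using (here)
open import Data.List.Relation.Unary.Linked using (Linked; []; [-]; _∷_)
open import Data.List.Relation.Unary.Unique.Propositional using (Unique)
import Data.List.Relation.Unary.Unique.Propositional.Properties as Unique
open import Data.Maybe using (just)
open import Data.Nat using (ℕ; zero; suc; _+_; _∸_; _≤_; _<_; _>_; _≤ᵇ_; _<ᵇ_; _≡ᵇ_; z≤n; s≤s)
open import Data.Nat.ListAction.Properties using (sum-↭)
open import Data.Nat.Properties
  using (_≤?_; _<?_; ≤ᵇ⇒≤; ≤⇒≤ᵇ; ≡ᵇ⇒≡; ≡⇒≡ᵇ; <-cmp; <-irrefl; <-asym; ≤-refl; ≤-trans; ≤-<-trans; <⇒≤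
        ; n≤1+n; m≤m+n; +-monoʳ-<; m+[n∸m]≡n; m∸n+n≡m; +-comm; +-assoc; +-cancelʳ-≡; suc-injective
        ; +-commutativeSemigroup)
open import Algebra.Properties.CommutativeSemigroup +-commutativeSemigroup
  using () renaming (interchange to +-interchange)
open import Data.Product using (_×_; _,_; proj₁; proj₂; map₂; Σ-syntax)
open import Data.Sum using (inj₁; inj₂)
open import Data.Unit using (tt)
open import Function using (_∘_; _∘′_; Equivalence; mk⇔)
open import Relation.Binary.Core using (_Preserves_⟶_)
open import Relation.Binary.Definitions using (tri<; tri≈; tri>)
open import Relation.Binary.PropositionalEquality
  using (_≡_; _≢_; refl; sym; trans; cong; cong₂; subst; setoid; module ≡-Reasoning)
open import Relation.Nullary using (¬_)
open import Relation.Nullary.Decidable using (T?; dec-true; dec-false)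

private
  open module XorSolver = xor-∧-Solver using (solve; _:=_; _:+_; con)

T-∧⁻ : ∀ {a b} → T (a ∧ b) → T a × T b
T-∧⁻ = Equivalence.to T-∧

T-∧⁺ : ∀ {a b} → T a → T b → T (a ∧ b)
T-∧⁺ p q = Equivalence.from T-∧ (p , q)

<ᵇ-true : ∀ {m n} → m < n → (m <ᵇ n) ≡ true
<ᵇ-true {m} {n} = dec-true (m <? n)

<ᵇ-false : ∀ {m n} → ¬ m < n → (m <ᵇ n) ≡ false
<ᵇ-false {m} {n} = dec-false (m <? n)

<ᵇ-flip : ∀ {m n} → m ≢ n → (n <ᵇ m) ≡ not (m <ᵇ n)
<ᵇ-flip {m} {n} m≢n with <-cmp m n
... | tri< m<n _ _ = trans (<ᵇ-false (<-asym m<n)) (cong not (sym (<ᵇ-true m<n)))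
... | tri≈ _ m≡n _ = ⊥-elim (m≢n m≡n)
... | tri> _ _ n<m = trans (<ᵇ-true n<m) (cong not (sym (<ᵇ-false (<-asym n<m))))

≤ᵇ-flip : ∀ m n → (suc n ≤ᵇ m) ≡ not (m ≤ᵇ n)
≤ᵇ-flip zero          n       = refl
≤ᵇ-flip (suc m)       zero    = refl
≤ᵇ-flip (suc zero)    (suc n) = refl
≤ᵇ-flip (suc (suc m)) (suc n) = ≤ᵇ-flip (suc m) n

∉⇒¬elemᵇ : ∀ {x ys} → All (x ≢_) ys → T (not (elemᵇ x ys))
∉⇒¬elemᵇ                []           = tt
∉⇒¬elemᵇ {x} {y ∷ ys} (x≢y ∷ x∉ys) with x ≡ᵇ y in x≡ᵇy
... | false = ∉⇒¬elemᵇ x∉ys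
... | true  = ⊥-elim (x≢y (≡ᵇ⇒≡ x y (subst T (sym x≡ᵇy) tt)))

¬elemᵇ⇒∉ : ∀ x ys → T (not (elemᵇ x ys)) → All (x ≢_) ys
¬elemᵇ⇒∉ x []       _    = []
¬elemᵇ⇒∉ x (y ∷ ys) x∉ys with x ≡ᵇ y in x≡ᵇy
... | false = (λ x≡y → subst T x≡ᵇy (≡⇒≡ᵇ x y x≡y)) ∷ ¬elemᵇ⇒∉ x ys x∉ys

distinctᵇ⇒Unique : ∀ xs → T (distinctᵇ xs) → Unique xs
distinctᵇ⇒Unique []       _ = []
distinctᵇ⇒Unique (x ∷ xs) d = let x∉xs , xs! = T-∧⁻ d in ¬elemᵇ⇒∉ x xs x∉xs ∷ distinctᵇ⇒Unique xs xs!

Unique⇒distinctᵇ : ∀ {xs} → Unique xs → T (distinctᵇ xs)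
Unique⇒distinctᵇ []           = tt
Unique⇒distinctᵇ (x∉xs ∷ xs!) = T-∧⁺ (∉⇒¬elemᵇ x∉xs) (Unique⇒distinctᵇ xs!)

xor-interchange : ∀ a b c d → (a xor b) xor (c xor d) ≡ (a xor c) xor (b xor d)
xor-interchange = solve 4 (λ a b c d → (a :+ b) :+ (c :+ d) := (a :+ c) :+ (b :+ d)) refl

xor-regroup : ∀ a b c d → (a xor b) xor (c xor d) ≡ a xor ((b xor c) xor d)
xor-regroup = solve 4 (λ a b c d → (a :+ b) :+ (c :+ d) := a :+ ((b :+ c) :+ d)) refl

xor-leftSwap : ∀ a b c → a xor (b xor c) ≡ b xor (a xor c)
xor-leftSwap = solve 3 (λ a b c → a :+ (b :+ c) := b :+ (a :+ c)) refl

Unique-↭ : ∀ {A : Set} {xs ys : List A} → xs ↭ ys → Unique xs → Unique ys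
Unique-↭ {A} xs↭ys = PermutationSetoid.Unique-resp-↭ (setoid A) (↭⇒↭ₛ xs↭ys)

Unique-++⁻ : ∀ {A : Set} (xs : List A) {ys} → Unique (xs ++ ys) → Unique xs × Unique ys
Unique-++⁻ []       ys!            = [] , ys!
Unique-++⁻ (x ∷ xs) (x∉xys ∷ xys!) =
  let xs! , ys! = Unique-++⁻ xs xys! in (proj₁ (All.++⁻ xs x∉xys) ∷ xs!) , ys!

-- Sums over a sign-reversing involution

sumℤ-↭ : sumℤ Preserves _↭_ ⟶ _≡_
sumℤ-↭ p = PermutationSetoid.foldr-commMonoid (setoid ℤ) +-0-isCommutativeMonoid (↭⇒↭ₛ p)

sumℤ-map-neg : ∀ zs → sumℤ (map -_ zs) ≡ - sumℤ zs
sumℤ-map-neg []       = refl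
sumℤ-map-neg (z ∷ zs) = trans (cong ((- z) +ℤ_) (sumℤ-map-neg zs)) (sym (neg-distrib-+ z (sumℤ zs)))

z≡-z⇒z≡0 : ∀ {z} → z ≡ - z → z ≡ 0ℤ
z≡-z⇒z≡0 {+ zero}    _  = refl
z≡-z⇒z≡0 {+ suc _}   ()
z≡-z⇒z≡0 { -[1+ _ ]} ()

module _ {A : Set} {xs : List A} (σ : A → A) (σ-involutive : ∀ x → σ (σ x) ≡ x)
         (σ-closed : ∀ {x} → x ∈ xs → σ x ∈ xs) where

  map-involution-↭ : Unique xs → map σ xs ↭ xs
  map-involution-↭ xs! = ∼bag⇒↭ (unique∧set⇒bag σxs! xs! (mk⇔ to from))
    where
    σxs! : Unique (map σ xs)
    σxs! = Unique.map⁺ (λ {x} {y} σx≡σy → trans (sym (σ-involutive x)) (trans (cong σ σx≡σy) (σ-involutive y))) xs!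
    to : ∀ {y} → y ∈ map σ xs → y ∈ xs
    to y∈ with x , x∈ , refl ← ∈-map⁻ σ y∈ = σ-closed x∈
    from : ∀ {y} → y ∈ xs → y ∈ map σ xs
    from {y} y∈ = subst (_∈ map σ xs) (σ-involutive y) (∈-map⁺ σ (σ-closed y∈))

  sumℤ-signReversing≡0 : Unique xs → (g : A → ℤ) → (∀ {x} → x ∈ xs → g (σ x) ≡ - g x) →
                         sumℤ (map g xs) ≡ 0ℤ
  sumℤ-signReversing≡0 xs! g g∘σ≡-g = z≡-z⇒z≡0 (begin
    sumℤ (map g xs)            ≡⟨ sumℤ-↭ (↭-map⁺ g (map-involution-↭ xs!)) ⟨
    sumℤ (map g (map σ xs))    ≡⟨ cong sumℤ (map-∘ xs) ⟨
    sumℤ (map (g ∘′ σ) xs)     ≡⟨ cong sumℤ (map-cong-local (All.tabulate g∘σ≡-g)) ⟩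
    sumℤ (map (-_ ∘′ g) xs)    ≡⟨ cong sumℤ (map-∘ xs) ⟩
    sumℤ (map -_ (map g xs))   ≡⟨ sumℤ-map-neg (map g xs) ⟩
    - sumℤ (map g xs)          ∎)
    where open ≡-Reasoning

-- Parity of the crossing number

parity : {A : Set} → (A → Bool) → List A → Bool
parity p = foldr (λ x b → p x xor b) false

module _ {A : Set} where

  even-length-filterᵇ : (p : A → Bool) (xs : List A) → evenᵇ (length (filterᵇ p xs)) ≡ not (parity p xs)
  even-length-filterᵇ p []       = refl
  even-length-filterᵇ p (x ∷ xs) with p x
  ... | true  = cong not (even-length-filterᵇ p xs)
  ... | false = even-length-filterᵇ p xs

  parity-++ : (p : A → Bool) (xs ys : List A) → parity p (xs ++ ys) ≡ parity p xs xor parity p ys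
  parity-++ p []       ys = refl
  parity-++ p (x ∷ xs) ys = trans (cong (p x xor_) (parity-++ p xs ys)) (sym (xor-assoc (p x) _ _))

  parity-cong : {p q : A → Bool} (xs : List A) → All (λ x → p x ≡ q x) xs → parity p xs ≡ parity q xs
  parity-cong []       []           = refl
  parity-cong (x ∷ xs) (px≡qx ∷ ps) = cong₂ _xor_ px≡qx (parity-cong xs ps)

  parity-xor : (p q : A → Bool) (xs : List A) → parity (λ x → p x xor q x) xs ≡ parity p xs xor parity q xs
  parity-xor p q []       = refl
  parity-xor p q (x ∷ xs) = trans (cong ((p x xor q x) xor_) (parity-xor p q xs))
    (xor-interchange (p x) (q x) (parity p xs) (parity q xs))

  parity-↭ : (p : A → Bool) {xs ys : List A} → xs ↭ ys → parity p xs ≡ parity p ys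
  parity-↭ p Perm.refl                = refl
  parity-↭ p (Perm.prep x xs↭ys)      = cong (p x xor_) (parity-↭ p xs↭ys)
  parity-↭ p (Perm.swap x y xs↭ys)    = trans (cong (λ b → p x xor (p y xor b)) (parity-↭ p xs↭ys))
    (xor-leftSwap (p x) (p y) _)
  parity-↭ p (Perm.trans xs↭ys ys↭zs) = trans (parity-↭ p xs↭ys) (parity-↭ p ys↭zs)

parity-cartesianProduct : {A B : Set} (p : A × B → Bool) (xs : List A) (ys : List B) →
  parity p (cartesianProduct xs ys) ≡ parity (λ x → parity (λ y → p (x , y)) ys) xs
parity-cartesianProduct p []       ys = refl
parity-cartesianProduct p (x ∷ xs) ys = trans (parity-++ p (map (x ,_) ys) _)
  (cong₂ _xor_ (parity-map ys) (parity-cartesianProduct p xs ys))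
  where
  parity-map : ∀ ys → parity p (map (x ,_) ys) ≡ parity (λ y → p (x , y)) ys
  parity-map []       = refl
  parity-map (y ∷ ys) = cong (p (x , y) xor_) (parity-map ys)

sign-parity : ∀ c → sign c ≡ (if evenᵇ c then 1ℤ else - 1ℤ)
sign-parity zero = refl
sign-parity (suc c) rewrite sign-parity c with evenᵇ c
... | true  = refl
... | false = refl

sign-flip : ∀ c c′ → evenᵇ c′ ≡ not (evenᵇ c) → sign c′ ≡ - sign c
sign-flip c c′ c′-odd rewrite sign-parity c | sign-parity c′ | c′-odd with evenᵇ c
... | true  = refl
... | false = refl

crosses : LInt → LInt → Bool
crosses s t = (lu s <ᵇ lu t) ∧ (lu t <ᵇ lv s) ∧ (lv s <ᵇ lv t)

crosses-irrefl : ∀ s → crosses s s ≡ false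
crosses-irrefl s rewrite <ᵇ-false (<-irrefl (refl {x = lu s})) = refl

pairCrosses : LInt → LInt → Bool
pairCrosses s t = crosses s t xor crosses t s

crossParity : List LInt → Bool
crossParity ι = parity (λ s → parity (crosses s) ι) ι

even-crossing : ∀ ι → evenᵇ (crossing ι) ≡ not (crossParity ι)
even-crossing ι = trans (even-length-filterᵇ _ (cartesianProduct ι ι))
  (cong not (parity-cartesianProduct (λ p → crosses (proj₁ p) (proj₂ p)) ι ι))

crossParity-↭ : ∀ {ι ι′} → ι ↭ ι′ → crossParity ι ≡ crossParity ι′
crossParity-↭ {ι} {ι′} ι↭ι′ =
  trans (parity-cong ι (All.tabulate (λ {s} _ → parity-↭ (crosses s) ι↭ι′)))
        (parity-↭ (λ s → parity (crosses s) ι′) ι↭ι′)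

crossParity-∷ : ∀ x xs → crossParity (x ∷ xs) ≡ crosses x x xor (parity (pairCrosses x) xs xor crossParity xs)
crossParity-∷ x xs = begin
  (crosses x x xor P) xor parity (λ s → crosses s x xor parity (crosses s) xs) xs
    ≡⟨ cong ((crosses x x xor P) xor_) (parity-xor (λ s → crosses s x) _ xs) ⟩
  (crosses x x xor P) xor (Q xor crossParity xs)
    ≡⟨ xor-regroup (crosses x x) P Q (crossParity xs) ⟩
  crosses x x xor ((P xor Q) xor crossParity xs)
    ≡⟨ cong (λ b → crosses x x xor (b xor crossParity xs)) (parity-xor (crosses x) (λ s → crosses s x) xs) ⟨
  crosses x x xor (parity (pairCrosses x) xs xor crossParity xs) ∎
  where
  open ≡-Reasoning
  P = parity (crosses x) xs
  Q = parity (λ s → crosses s x) xs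

crossParity-∷∷ : ∀ x y zs → crossParity (x ∷ y ∷ zs) ≡
  pairCrosses x y xor (parity (λ z → pairCrosses x z xor pairCrosses y z) zs xor crossParity zs)
crossParity-∷∷ x y zs = begin
  crossParity (x ∷ y ∷ zs)
    ≡⟨ crossParity-∷ x (y ∷ zs) ⟩
  crosses x x xor ((pairCrosses x y xor P) xor crossParity (y ∷ zs))
    ≡⟨ cong₂ (λ c d → c xor ((pairCrosses x y xor P) xor d)) (crosses-irrefl x) (crossParity-∷ y zs) ⟩
  (pairCrosses x y xor P) xor (crosses y y xor (Q xor crossParity zs))
    ≡⟨ cong (λ c → (pairCrosses x y xor P) xor (c xor (Q xor crossParity zs))) (crosses-irrefl y) ⟩
  (pairCrosses x y xor P) xor (Q xor crossParity zs)
    ≡⟨ xor-regroup (pairCrosses x y) P Q (crossParity zs) ⟩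
  pairCrosses x y xor ((P xor Q) xor crossParity zs)
    ≡⟨ cong (λ b → pairCrosses x y xor (b xor crossParity zs)) (parity-xor (pairCrosses x) (pairCrosses y) zs) ⟨
  pairCrosses x y xor (parity (λ z → pairCrosses x z xor pairCrosses y z) zs xor crossParity zs) ∎
  where
  open ≡-Reasoning
  P = parity (pairCrosses x) zs
  Q = parity (pairCrosses y) zs

record Overlap (s t : LInt) : Set where
  field
    starts≢ : lu s ≢ lu t
    ends≢   : lv s ≢ lv t
    s<t     : lu s < lv t
    t<s     : lu t < lv s

-- Overlapping intervals are nested or crossing; they cross iff their left endpoints and their
-- right endpoints come in the same order.
pairCrosses-overlap : ∀ {s t} → Overlap s t → pairCrosses s t ≡ not ((lu s <ᵇ lu t) xor (lv s <ᵇ lv t))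
pairCrosses-overlap {s} {t} o
  rewrite <ᵇ-true (Overlap.s<t o) | <ᵇ-true (Overlap.t<s o)
        | <ᵇ-flip (Overlap.starts≢ o) | <ᵇ-flip (Overlap.ends≢ o)
  = nested-or-crossing (lu s <ᵇ lu t) (lv s <ᵇ lv t)
  where
  nested-or-crossing : ∀ a c → (a ∧ c) xor (not a ∧ not c) ≡ not (a xor c)
  nested-or-crossing true  true  = refl
  nested-or-crossing true  false = refl
  nested-or-crossing false true  = refl
  nested-or-crossing false false = refl

module _ {u₁ v₁ u₂ v₂ a b : ℕ} where

  private
    x y x′ y′ : LInt
    x  = u₁ , v₁ , a
    y  = u₂ , v₂ , b
    x′ = u₁ , v₂ , a
    y′ = u₂ , v₁ , b

  crossParity-exchange : ∀ zs → Overlap x y → u₁ < v₁ → u₂ < v₂ → All (λ z → Overlap x z × Overlap y z) zs →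
                         crossParity (x′ ∷ y′ ∷ zs) ≡ not (crossParity (x ∷ y ∷ zs))
  crossParity-exchange zs xy u₁<v₁ u₂<v₂ overlaps = begin
    crossParity (x′ ∷ y′ ∷ zs)
      ≡⟨ crossParity-∷∷ x′ y′ zs ⟩
    pairCrosses x′ y′ xor (parity (λ z → pairCrosses x′ z xor pairCrosses y′ z) zs xor crossParity zs)
      ≡⟨ cong₂ (λ e f → e xor (f xor crossParity zs)) pair-flips (parity-cong zs (All.map others-kept overlaps)) ⟩
    not (pairCrosses x y) xor (parity (λ z → pairCrosses x z xor pairCrosses y z) zs xor crossParity zs)
      ≡⟨ not-distribˡ-xor (pairCrosses x y) _ ⟨
    not (pairCrosses x y xor (parity (λ z → pairCrosses x z xor pairCrosses y z) zs xor crossParity zs))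
      ≡⟨ cong not (crossParity-∷∷ x y zs) ⟨
    not (crossParity (x ∷ y ∷ zs)) ∎
    where
    open ≡-Reasoning
    open Overlap

    pair-flips : pairCrosses x′ y′ ≡ not (pairCrosses x y)
    pair-flips
      rewrite pairCrosses-overlap {x′} {y′}
                (record { starts≢ = starts≢ xy ; ends≢ = ends≢ xy ∘ sym ; s<t = u₁<v₁ ; t<s = u₂<v₂ })
            | pairCrosses-overlap xy | <ᵇ-flip (ends≢ xy)
      = cong not (sym (not-distribʳ-xor (u₁ <ᵇ u₂) (v₁ <ᵇ v₂)))

    others-kept : ∀ {z} → Overlap x z × Overlap y z →
                  pairCrosses x′ z xor pairCrosses y′ z ≡ pairCrosses x z xor pairCrosses y z
    others-kept {z} (xz , yz)
      rewrite pairCrosses-overlap {x′} {z}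
                (record { starts≢ = starts≢ xz ; ends≢ = ends≢ yz ; s<t = s<t xz ; t<s = t<s yz })
            | pairCrosses-overlap {y′} {z}
                (record { starts≢ = starts≢ yz ; ends≢ = ends≢ xz ; s<t = s<t yz ; t<s = t<s xz })
            | pairCrosses-overlap xz | pairCrosses-overlap yz
      -- `not b` reduces to `true xor b`, which the ring solver can read.
      = solve 4 (λ a b c d → (con true :+ (a :+ d)) :+ (con true :+ (b :+ c))
                           := (con true :+ (a :+ c)) :+ (con true :+ (b :+ d)))
                refl (u₁ <ᵇ lu z) (u₂ <ᵇ lu z) (v₁ <ᵇ lv z) (v₂ <ᵇ lv z)

-- Snake sequences

module SnakeParity {λ′ : List ℕ} (weaklyDecreasing : Linked (λ a b → b ≤ a) λ′) where

  row-suc-≤ : ∀ i → row λ′ (suc (suc i)) ≤ row λ′ (suc i)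
  row-suc-≤ = go weaklyDecreasing
    where
    go : ∀ {xs} → Linked (λ a b → b ≤ a) xs → ∀ i → row xs (suc (suc i)) ≤ row xs (suc i)
    go []           _       = z≤n
    go [-]          _       = z≤n
    go (y≤x ∷ _)    zero    = y≤x
    go (_ ∷ linked) (suc i) = go linked i

  private
    square : ∀ {i j} → suc j ≤ row λ′ (suc i) → inDiagram λ′ (suc i , suc j) ≡ true
    square {i} {j} = dec-true (suc j ≤? row λ′ (suc i))

    snakeSize : List (ℕ × ℕ) → ℕ
    snakeSize squares = length (filterᵇ (inDiagram λ′) squares)

  -- upFirst (1+i) j and leftFirst i (1+j) are the snakes of the lower and of the right-hand edge
  -- of the square (1+i, 1+j) without that square.
  mutual
    even-upFirst : ∀ i j → j ≤ row λ′ (suc i) → evenᵇ (snakeSize (upFirst (suc i) j)) ≡ (j ≤ᵇ i)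
    even-upFirst i zero    _ = refl
    even-upFirst i (suc j) h rewrite square h =
      trans (cong not (even-leftFirst i j h)) (sym (≤ᵇ-flip i j))

    even-leftFirst : ∀ i j → suc j ≤ row λ′ (suc i) → evenᵇ (snakeSize (leftFirst i (suc j))) ≡ (i ≤ᵇ j)
    even-leftFirst zero    j _ = refl
    even-leftFirst (suc i) j h rewrite square (≤-trans h (row-suc-≤ i)) =
      trans (cong not (even-upFirst i j (≤-trans (n≤1+n j) (≤-trans h (row-suc-≤ i))))) (sym (≤ᵇ-flip j i))

  even-snakeLength-hor : ∀ {i j} → suc j ≤ row λ′ (suc i) →
                         evenᵇ (snakeLength λ′ (hor (suc i) (suc j))) ≡ (j ≤ᵇ i)
  even-snakeLength-hor {i} {j} h rewrite square h = even-upFirst i j (≤-trans (n≤1+n j) h)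

  even-snakeLength-ver : ∀ {i j} → suc j ≤ row λ′ (suc i) →
                         evenᵇ (snakeLength λ′ (ver (suc i) (suc j))) ≡ (i ≤ᵇ j)
  even-snakeLength-ver {i} {j} h rewrite square h = even-leftFirst i j h

LsPrecedeRs : List Letter → Set
LsPrecedeRs = AllPairs (λ c d → c ≡ R → d ≢ L)

noR⇒LsPrecedeRs : ∀ {cs} → All (_≢ R) cs → LsPrecedeRs cs
noR⇒LsPrecedeRs []          = []
noR⇒LsPrecedeRs (c≢R ∷ noR) = All.tabulate (λ _ c≡R → ⊥-elim (c≢R c≡R)) ∷ noR⇒LsPrecedeRs noR

LsPrecedeRs-++ : ∀ {cs ds} → LsPrecedeRs cs → LsPrecedeRs ds → (R ∈ cs → All (_≢ L) ds) →
                 LsPrecedeRs (cs ++ ds)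
LsPrecedeRs-++ {cs} cs-ordered ds-ordered R∈cs⇒noL = AllPairs.++⁺ cs-ordered ds-ordered
  (All.tabulate λ c∈cs → All.tabulate λ d∈ds c≡R → All.lookup (R∈cs⇒noL (subst (_∈ cs) c≡R c∈cs)) d∈ds)

qAt-All : ∀ {P : Letter → Set} {cs p c} → All P cs → qAt cs p ≡ just c → P c
qAt-All {p = suc zero}    (pc ∷ _)  refl = pc
qAt-All {p = suc (suc p)} (_ ∷ pcs) q≡c  = qAt-All {p = suc p} pcs q≡c

qAt-L<qAt-R : ∀ {cs} → LsPrecedeRs cs → ∀ p r → qAt cs p ≡ just L → qAt cs r ≡ just R → p < r
qAt-L<qAt-R {c ∷ cs} _             (suc zero)    (suc zero)    refl ()
qAt-L<qAt-R {c ∷ cs} _             (suc zero)    (suc (suc r)) _    _    = s≤s (s≤s z≤n)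
qAt-L<qAt-R {c ∷ cs} (noL ∷ _)     (suc (suc p)) (suc zero)    q≡L  refl =
  ⊥-elim (qAt-All {p = suc p} noL q≡L refl refl)
qAt-L<qAt-R {c ∷ cs} (_ ∷ ordered) (suc (suc p)) (suc (suc r)) q≡L  q≡R  =
  s≤s (qAt-L<qAt-R ordered (suc p) (suc r) q≡L q≡R)

row-positive : ∀ {xs a} → All (_> 0) xs → a < length xs → 0 < row xs (suc a)
row-positive {a = zero}  (x>0 ∷ _)  _         = x>0
row-positive {a = suc a} (_ ∷ xs>0) (s≤s a<ℓ) = row-positive xs>0 a<ℓ

module SnakeSequence {λ′ : List ℕ} (partition : IsPartition λ′) where

  open SnakeParity (proj₁ partition)

  private
    if-true : ∀ {b} {c d : Letter} → c ≢ d → (if b then c else d) ≡ c → T b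
    if-true {true}  _   _   = tt
    if-true {false} c≢d d≡c = c≢d (sym d≡c)

  letter-hor≢R : ∀ i j → letter λ′ (hor i j) ≢ R
  letter-hor≢R i j with evenᵇ (snakeLength λ′ (hor i j))
  ... | true  = λ ()
  ... | false = λ ()

  letter-ver≢L : ∀ i j → letter λ′ (ver i j) ≢ L
  letter-ver≢L i j with evenᵇ (snakeLength λ′ (ver i j))
  ... | true  = λ ()
  ... | false = λ ()

  letter-hor-L : ∀ {i j} → suc j ≤ row λ′ (suc i) → letter λ′ (hor (suc i) (suc j)) ≡ L → j ≤ i
  letter-hor-L {i} {j} h isL =
    ≤ᵇ⇒≤ j i (if-true (λ ()) (subst (λ b → (if b then L else O) ≡ L) (even-snakeLength-hor h) isL))

  letter-ver-R : ∀ {i k} → 0 < k → k ≤ row λ′ (suc i) → letter λ′ (ver (suc i) k) ≡ R → suc i ≤ k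
  letter-ver-R {i} {suc j} _ h isR =
    s≤s (≤ᵇ⇒≤ i j (if-true (λ ()) (subst (λ b → (if b then R else O) ≡ R) (even-snakeLength-ver h) isR)))

  rowLetters : ℕ → List Letter
  rowLetters i = map (letter λ′) (envRow λ′ i)

  private
    horLetters : ℕ → List Letter
    horLetters i = map (letter λ′) (map (λ t → hor i (suc (row λ′ (suc i) + t))) (upTo (row λ′ i ∸ row λ′ (suc i))))

    rowLetters-split : ∀ i → rowLetters i ≡ horLetters i ++ letter λ′ (ver i (row λ′ i)) ∷ []
    rowLetters-split i = map-++ (letter λ′) _ (ver i (row λ′ i) ∷ [])

    horLetters≢R : ∀ i → All (_≢ R) (horLetters i)
    horLetters≢R i = All.map⁺ (All.map⁺ (All.applyUpTo⁺₂ _ _ (λ t → letter-hor≢R i (suc (row λ′ (suc i) + t)))))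

  rowLetters-LsPrecedeRs : ∀ i → LsPrecedeRs (rowLetters i)
  rowLetters-LsPrecedeRs i rewrite rowLetters-split i =
    LsPrecedeRs-++ (noR⇒LsPrecedeRs (horLetters≢R i)) ([] ∷ [])
      (λ R∈ → ⊥-elim (All.lookup (horLetters≢R i) R∈ refl))

  R∈rowLetters : ∀ {a} → a < length λ′ → R ∈ rowLetters (suc a) → suc a ≤ row λ′ (suc a)
  R∈rowLetters {a} a<ℓ R∈ rewrite rowLetters-split (suc a) with ∈-++⁻ (horLetters (suc a)) R∈
  ... | inj₁ R∈hor      = ⊥-elim (All.lookup (horLetters≢R (suc a)) R∈hor refl)
  ... | inj₂ (here isR) = letter-ver-R (row-positive (proj₂ partition) a<ℓ) ≤-refl (sym isR)

  rowLetters-noL : ∀ {a} → suc a ≤ row λ′ (suc (suc a)) → All (_≢ L) (rowLetters (suc a))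
  rowLetters-noL {a} a<r₁ rewrite rowLetters-split (suc a) =
    All.++⁺ (All.map⁺ (All.map⁺ (All.applyUpTo⁺₁ _ _ λ {t} → hor≢L {t})))
            (letter-ver≢L (suc a) (row λ′ (suc a)) ∷ [])
    where
    r₁ = row λ′ (suc (suc a))
    hor≢L : ∀ {t} → t < row λ′ (suc a) ∸ r₁ → letter λ′ (hor (suc a) (suc (r₁ + t))) ≢ L
    hor≢L {t} t<d isL = <-irrefl refl (≤-<-trans (≤-trans a<r₁ (m≤m+n r₁ t)) (s≤s (letter-hor-L inside isL)))
      where
      inside : suc (r₁ + t) ≤ row λ′ (suc a)
      inside = subst (suc (r₁ + t) ≤_) (m+[n∸m]≡n (row-suc-≤ a)) (+-monoʳ-< r₁ t<d)

  rowsFrom : ℕ → List Letter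
  rowsFrom n = concatMap (λ a → rowLetters (suc a)) (downFrom n)

  rowsFrom-noL : ∀ m → m ≤ row λ′ (suc m) → All (_≢ L) (rowsFrom m)
  rowsFrom-noL zero    _ = []
  rowsFrom-noL (suc m) h =
    All.++⁺ (rowLetters-noL h) (rowsFrom-noL m (≤-trans (n≤1+n m) (≤-trans h (row-suc-≤ m))))

  rowsFrom-LsPrecedeRs : ∀ n → n ≤ length λ′ → LsPrecedeRs (rowsFrom n)
  rowsFrom-LsPrecedeRs zero    _   = []
  rowsFrom-LsPrecedeRs (suc n) n<ℓ =
    LsPrecedeRs-++ (rowLetters-LsPrecedeRs (suc n)) (rowsFrom-LsPrecedeRs n (<⇒≤ n<ℓ))
      (λ R∈ → rowsFrom-noL n (≤-trans (n≤1+n n) (R∈rowLetters n<ℓ R∈)))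

  SS-rows : SS λ′ ≡ rowsFrom (length λ′)
  SS-rows = begin
    map (letter λ′) (concatMap (envRow λ′) (reverse (map suc (upTo ℓ))))
      ≡⟨ cong (map (letter λ′) ∘ concatMap (envRow λ′))
              (trans (sym (reverse-map suc (upTo ℓ))) (cong (map suc) (reverse-upTo ℓ))) ⟩
    map (letter λ′) (concatMap (envRow λ′) (map suc (downFrom ℓ)))
      ≡⟨ map-concatMap (letter λ′) (envRow λ′) (map suc (downFrom ℓ)) ⟩
    concatMap rowLetters (map suc (downFrom ℓ))
      ≡⟨ concatMap-map rowLetters suc (downFrom ℓ) ⟩
    rowsFrom ℓ ∎
    where
    open ≡-Reasoning
    ℓ = length λ′

  SS-L<R : ∀ p r → qAt (SS λ′) p ≡ just L → qAt (SS λ′) r ≡ just R → p < r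
  SS-L<R = qAt-L<qAt-R (subst LsPrecedeRs (sym SS-rows) (rowsFrom-LsPrecedeRs (length λ′) ≤-refl))

-- The switch

exchangeEnd : ℕ → ℕ → List LInt → ℕ × List LInt
exchangeEnd a v []                   = v , []
exchangeEnd a v ((u′ , v′ , b) ∷ ts) =
  if a ≡ᵇ b then (v′ , (u′ , v , b) ∷ ts) else map₂ ((u′ , v′ , b) ∷_) (exchangeEnd a v ts)

switch : List LInt → List LInt
switch []                 = []
switch ((u , v , a) ∷ ts) =
  if elemᵇ a (map lab ts)
  then (u , proj₁ (exchangeEnd a v ts) , a) ∷ proj₂ (exchangeEnd a v ts)
  else (u , v , a) ∷ switch ts

map-lab-exchangeEnd : ∀ a v ts → map lab (proj₂ (exchangeEnd a v ts)) ≡ map lab ts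
map-lab-exchangeEnd a v []                   = refl
map-lab-exchangeEnd a v ((u′ , v′ , b) ∷ ts) with a ≡ᵇ b
... | true  = refl
... | false = cong (b ∷_) (map-lab-exchangeEnd a v ts)

exchangeEnd-involutive : ∀ a v ts →
  exchangeEnd a (proj₁ (exchangeEnd a v ts)) (proj₂ (exchangeEnd a v ts)) ≡ (v , ts)
exchangeEnd-involutive a v []                   = refl
exchangeEnd-involutive a v ((u′ , v′ , b) ∷ ts) with a ≡ᵇ b in a≡ᵇb
... | true  rewrite a≡ᵇb = refl
... | false rewrite a≡ᵇb | exchangeEnd-involutive a v ts = refl

map-lab-switch : ∀ ts → map lab (switch ts) ≡ map lab ts
map-lab-switch []                 = refl
map-lab-switch ((u , v , a) ∷ ts) with elemᵇ a (map lab ts)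
... | true  = cong (a ∷_) (map-lab-exchangeEnd a v ts)
... | false = cong (a ∷_) (map-lab-switch ts)

switch-involutive : ∀ ts → switch (switch ts) ≡ ts
switch-involutive []                 = refl
switch-involutive ((u , v , a) ∷ ts) with elemᵇ a (map lab ts) in recurs
... | true  rewrite map-lab-exchangeEnd a v ts | recurs | exchangeEnd-involutive a v ts = refl
... | false rewrite map-lab-switch ts | recurs | switch-involutive ts = refl

record Exchanged (ι ι′ : List LInt) : Set where
  field
    u₁ v₁ u₂ v₂ a : ℕ
    pre mid post  : List LInt
    before : ι  ≡ pre ++ (u₁ , v₁ , a) ∷ mid ++ (u₂ , v₂ , a) ∷ post
    after  : ι′ ≡ pre ++ (u₁ , v₂ , a) ∷ mid ++ (u₂ , v₁ , a) ∷ post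

  x y x′ y′ : LInt
  x  = u₁ , v₁ , a
  y  = u₂ , v₂ , a
  x′ = u₁ , v₂ , a
  y′ = u₂ , v₁ , a

  rest : List LInt
  rest = pre ++ mid ++ post

exchangeEnd-split : ∀ a v ts → T (elemᵇ a (map lab ts)) →
  Σ[ mid ∈ List LInt ] Σ[ u₂ ∈ ℕ ] Σ[ v₂ ∈ ℕ ] Σ[ post ∈ List LInt ]
    (ts ≡ mid ++ (u₂ , v₂ , a) ∷ post) × (exchangeEnd a v ts ≡ (v₂ , mid ++ (u₂ , v , a) ∷ post))
exchangeEnd-split a v ((u′ , v′ , b) ∷ ts) recurs with a ≡ᵇ b in a≡ᵇb
... | true  rewrite ≡ᵇ⇒≡ a b (subst T (sym a≡ᵇb) tt) = [] , u′ , v′ , ts , refl , refl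
... | false with mid , u₂ , v₂ , post , ts≡ , exchanged ← exchangeEnd-split a v ts recurs rewrite exchanged
  = (u′ , v′ , b) ∷ mid , u₂ , v₂ , post , cong ((u′ , v′ , b) ∷_) ts≡ , refl

switch-exchanged : ∀ ts → T (repeatedLabelᵇ ts) → Exchanged ts (switch ts)
switch-exchanged ((u , v , a) ∷ ts) repeated with elemᵇ a (map lab ts) in recurs
... | true with mid , u₂ , v₂ , post , ts≡ , exchanged ← exchangeEnd-split a v ts (subst T (sym recurs) tt)
  rewrite exchanged
  = record { pre = [] ; mid = mid ; post = post ; before = cong ((u , v , a) ∷_) ts≡ ; after = refl }
... | false = record
  { pre = (u , v , a) ∷ pre ; mid = mid ; post = post
  ; before = cong ((u , v , a) ∷_) before ; after = cong ((u , v , a) ∷_) after }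
  where open Exchanged (switch-exchanged ts repeated) using (pre; mid; post; before; after)

insert₂-↭ : ∀ {A : Set} (pre mid post : List A) s t → pre ++ s ∷ mid ++ t ∷ post ↭ s ∷ t ∷ pre ++ mid ++ post
insert₂-↭ pre mid post s t = begin
  pre ++ s ∷ mid ++ t ∷ post       ↭⟨ shift s pre (mid ++ t ∷ post) ⟩
  s ∷ pre ++ mid ++ t ∷ post       ≡⟨ cong (s ∷_) (++-assoc pre mid (t ∷ post)) ⟨
  s ∷ (pre ++ mid) ++ t ∷ post     ↭⟨ ↭-prep s (shift t (pre ++ mid) post) ⟩
  s ∷ t ∷ (pre ++ mid) ++ post     ≡⟨ cong (λ zs → s ∷ t ∷ zs) (++-assoc pre mid post) ⟩
  s ∷ t ∷ pre ++ mid ++ post       ∎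
  where open PermutationReasoning

map-insert₂ : ∀ {A B : Set} (f : A → B) (pre mid post : List A) s t →
              map f (pre ++ s ∷ mid ++ t ∷ post) ≡ map f pre ++ f s ∷ map f mid ++ f t ∷ map f post
map-insert₂ f pre mid post s t = trans (map-++ f pre _) (cong (λ zs → map f pre ++ f s ∷ zs) (map-++ f mid _))

∸-exchange : ∀ {u₁ v₁ u₂ v₂} → u₁ ≤ v₁ → u₂ ≤ v₂ → u₁ ≤ v₂ → u₂ ≤ v₁ →
             (v₁ ∸ u₁) + (v₂ ∸ u₂) ≡ (v₂ ∸ u₁) + (v₁ ∸ u₂)
∸-exchange {u₁} {v₁} {u₂} {v₂} u₁≤v₁ u₂≤v₂ u₁≤v₂ u₂≤v₁ = +-cancelʳ-≡ (u₁ + u₂) _ _ (begin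
  (v₁ ∸ u₁) + (v₂ ∸ u₂) + (u₁ + u₂)   ≡⟨ +-interchange (v₁ ∸ u₁) _ u₁ u₂ ⟩
  (v₁ ∸ u₁ + u₁) + (v₂ ∸ u₂ + u₂)     ≡⟨ cong₂ _+_ (m∸n+n≡m u₁≤v₁) (m∸n+n≡m u₂≤v₂) ⟩
  v₁ + v₂                             ≡⟨ +-comm v₁ v₂ ⟩
  v₂ + v₁                             ≡⟨ cong₂ _+_ (m∸n+n≡m u₁≤v₂) (m∸n+n≡m u₂≤v₁) ⟨
  (v₂ ∸ u₁ + u₁) + (v₁ ∸ u₂ + u₂)     ≡⟨ +-interchange (v₂ ∸ u₁) _ u₁ u₂ ⟨
  (v₂ ∸ u₁) + (v₁ ∸ u₂) + (u₁ + u₂)   ∎)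
  where open ≡-Reasoning

exponent-↭ : ∀ {ι ι′} b → ι ↭ ι′ → exponent ι b ≡ exponent ι′ b
exponent-↭ b ι↭ι′ = sum-↭ (↭-map⁺ _ (filter-↭ _ ι↭ι′))

module _ {ι ι′ : List LInt} (e : Exchanged ι ι′) where

  open Exchanged e

  before-↭ : ι ↭ x ∷ y ∷ rest
  before-↭ rewrite before = insert₂-↭ pre mid post x y

  after-↭ : ι′ ↭ x′ ∷ y′ ∷ rest
  after-↭ rewrite after = insert₂-↭ pre mid post x′ y′

  map-exchanged : ∀ {B : Set} (f : LInt → B) → (∀ {u v w c} → f (u , v , c) ≡ f (u , w , c)) → map f ι′ ≡ map f ι
  map-exchanged f ignoresEnd rewrite before | after = begin
    map f (pre ++ x′ ∷ mid ++ y′ ∷ post)                ≡⟨ map-insert₂ f pre mid post x′ y′ ⟩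
    map f pre ++ f x′ ∷ map f mid ++ f y′ ∷ map f post ≡⟨ cong₂ (λ s t → map f pre ++ s ∷ map f mid ++ t ∷ map f post)
                                                                ignoresEnd ignoresEnd ⟩
    map f pre ++ f x ∷ map f mid ++ f y ∷ map f post   ≡⟨ map-insert₂ f pre mid post x y ⟨
    map f (pre ++ x ∷ mid ++ y ∷ post)                  ∎
    where open ≡-Reasoning

  ends-↭ : map lv ι′ ↭ map lv ι
  ends-↭ = begin
    map lv ι′              ↭⟨ ↭-map⁺ lv after-↭ ⟩
    v₂ ∷ v₁ ∷ map lv rest  ↭⟨ ↭-swap v₂ v₁ ↭-refl ⟩
    v₁ ∷ v₂ ∷ map lv rest  ↭⟨ ↭-map⁺ lv before-↭ ⟨
    map lv ι               ∎
    where open PermutationReasoning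

  exponent-exchanged : u₁ ≤ v₁ → u₂ ≤ v₂ → u₁ ≤ v₂ → u₂ ≤ v₁ → ∀ b → exponent ι′ b ≡ exponent ι b
  exponent-exchanged u₁≤v₁ u₂≤v₂ u₁≤v₂ u₂≤v₁ b =
    trans (exponent-↭ b after-↭) (trans pair-exchanged (sym (exponent-↭ b before-↭)))
    where
    pair-exchanged : exponent (x′ ∷ y′ ∷ rest) b ≡ exponent (x ∷ y ∷ rest) b
    pair-exchanged with a ≡ᵇ b in a≡ᵇb
    ... | false rewrite a≡ᵇb = refl
    ... | true  rewrite a≡ᵇb = begin
      (v₂ ∸ u₁) + ((v₁ ∸ u₂) + exponent rest b) ≡⟨ +-assoc (v₂ ∸ u₁) _ _ ⟨
      (v₂ ∸ u₁) + (v₁ ∸ u₂) + exponent rest b   ≡⟨ cong (_+ exponent rest b) (∸-exchange u₁≤v₁ u₂≤v₂ u₁≤v₂ u₂≤v₁) ⟨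
      (v₁ ∸ u₁) + (v₂ ∸ u₂) + exponent rest b   ≡⟨ +-assoc (v₁ ∸ u₁) _ _ ⟩
      (v₁ ∸ u₁) + ((v₂ ∸ u₂) + exponent rest b) ∎
      where open ≡-Reasoning

  crossing-exchanged : Overlap x y → u₁ < v₁ → u₂ < v₂ → All (λ z → Overlap x z × Overlap y z) rest →
                       evenᵇ (crossing ι′) ≡ not (evenᵇ (crossing ι))
  crossing-exchanged xy u₁<v₁ u₂<v₂ overlaps = begin
    evenᵇ (crossing ι′)                     ≡⟨ even-crossing ι′ ⟩
    not (crossParity ι′)                    ≡⟨ cong not (crossParity-↭ after-↭) ⟩
    not (crossParity (x′ ∷ y′ ∷ rest))      ≡⟨ cong not (crossParity-exchange rest xy u₁<v₁ u₂<v₂ overlaps) ⟩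
    not (not (crossParity (x ∷ y ∷ rest)))  ≡⟨ cong (not ∘ not) (crossParity-↭ before-↭) ⟨
    not (not (crossParity ι))               ≡⟨ cong not (even-crossing ι) ⟨
    not (evenᵇ (crossing ι))                ∎
    where open ≡-Reasoning

module _ {A B : Set} (f : A → List B) where

  ∈-concatMap⁺′ : ∀ {xs x z} → x ∈ xs → z ∈ f x → z ∈ concatMap f xs
  ∈-concatMap⁺′ x∈xs z∈fx = ∈-concatMap⁺ f (Any.map (λ { refl → z∈fx }) x∈xs)

  Unique-concatMap⁺ : ∀ {xs} → Unique xs → (∀ x → Unique (f x)) → (∀ {x x′ z} → z ∈ f x → z ∈ f x′ → x ≡ x′) →
                      Unique (concatMap f xs)
  Unique-concatMap⁺ xs! f! tagged = Unique.concat⁺ (All.map⁺ (All.tabulate (λ {x} _ → f! x)))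
    (AllPairs.map⁺ (AllPairs.map (λ x≢x′ {_} (z∈fx , z∈fx′) → x≢x′ (tagged z∈fx z∈fx′)) xs!))

∈-oneTo⁺ : ∀ {i n} → 1 ≤ i → i ≤ n → i ∈ oneTo n
∈-oneTo⁺ {suc i} _ i<n = ∈-map⁺ suc (∈-upTo⁺ i<n)

oneTo-unique : ∀ n → Unique (oneTo n)
oneTo-unique n = Unique.map⁺ suc-injective (Unique.upTo⁺ n)

∈-triples⁺ : ∀ {m N u v a} → u ∈ oneTo m → v ∈ oneTo m → a ∈ oneTo N → (u , v , a) ∈ triples m N
∈-triples⁺ u∈ v∈ a∈ = ∈-concatMap⁺′ _ u∈ (∈-concatMap⁺′ _ v∈ (∈-map⁺ _ a∈))

triples-unique : ∀ m N → Unique (triples m N)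
triples-unique m N = Unique-concatMap⁺ _ (oneTo-unique m)
  (λ u → Unique-concatMap⁺ _ (oneTo-unique m) (λ v → Unique.map⁺ (cong lab) (oneTo-unique N))
    (λ z∈ z∈′ → trans (sym (proj₂ (ends-of z∈))) (proj₂ (ends-of z∈′))))
  (λ z∈ z∈′ → trans (sym (start-of z∈)) (start-of z∈′))
  where
  ends-of : ∀ {u v z} → z ∈ map (λ a → (u , v , a)) (oneTo N) → lu z ≡ u × lv z ≡ v
  ends-of z∈ with _ , _ , refl ← ∈-map⁻ _ z∈ = refl , refl
  start-of : ∀ {u z} → z ∈ concatMap (λ v → map (λ a → (u , v , a)) (oneTo N)) (oneTo m) → lu z ≡ u
  start-of {u} z∈ =
    proj₁ (ends-of (proj₂ (Any.satisfied (∈-concatMap⁻ (λ v → map (λ a → (u , v , a)) (oneTo N)) {oneTo m} z∈))))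

module _ {A : Set} (xs : List A) where

  listsOfLength-unique : Unique xs → ∀ k → Unique (listsOfLength k xs)
  listsOfLength-unique xs! zero    = [] ∷ []
  listsOfLength-unique xs! (suc k) = Unique-concatMap⁺ _ xs!
    (λ x → Unique.map⁺ (proj₂ ∘ ∷-injective) (listsOfLength-unique xs! k)) head-of
    where
    head-of : ∀ {x x′ z} → z ∈ map (x ∷_) (listsOfLength k xs) → z ∈ map (x′ ∷_) (listsOfLength k xs) → x ≡ x′
    head-of z∈ z∈′ with _ , _ , refl ← ∈-map⁻ _ z∈ | _ , _ , z≡ ← ∈-map⁻ _ z∈′ = ∷-injectiveˡ z≡

  ∈-listsOfLength⁺ : ∀ {ys} → All (_∈ xs) ys → ys ∈ listsOfLength (length ys) xs
  ∈-listsOfLength⁺ []             = here refl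
  ∈-listsOfLength⁺ (y∈xs ∷ ys∈xs) = ∈-concatMap⁺′ _ y∈xs (∈-map⁺ _ (∈-listsOfLength⁺ ys∈xs))

-- Candidates

module Candidates {λ′ : List ℕ} (partition : IsPartition λ′) (β : List ℕ) where

  open SnakeSequence partition using (SS-L<R)

  record Admissible (t : LInt) : Set where
    field
      1≤start   : 1 ≤ lu t
      start<end : lu t < lv t
      end≤m     : lv t ≤ length (SS λ′)
      startL    : qAt (SS λ′) (lu t) ≡ just L
      endR      : qAt (SS λ′) (lv t) ≡ just R

  open Admissible

  admissibleᵇ : LInt → Bool
  admissibleᵇ t = (1 ≤ᵇ lu t) ∧ (suc (lu t) ≤ᵇ lv t) ∧ (lv t ≤ᵇ length (SS λ′))
                  ∧ isL (qAt (SS λ′) (lu t)) ∧ isR (qAt (SS λ′) (lv t))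

  private
    isL⁻ : ∀ q → T (isL q) → q ≡ just L
    isL⁻ (just L) _ = refl

    isR⁻ : ∀ q → T (isR q) → q ≡ just R
    isR⁻ (just R) _ = refl

  admissible⁻ : ∀ t → T (admissibleᵇ t) → Admissible t
  admissible⁻ t h =
    let 1≤u , h₁  = T-∧⁻ h
        u<v , h₂  = T-∧⁻ h₁
        v≤m , h₃  = T-∧⁻ h₂
        atL , atR = T-∧⁻ h₃
    in record { 1≤start = ≤ᵇ⇒≤ 1 (lu t) 1≤u ; start<end = ≤ᵇ⇒≤ (suc (lu t)) (lv t) u<v
              ; end≤m = ≤ᵇ⇒≤ (lv t) _ v≤m ; startL = isL⁻ _ atL ; endR = isR⁻ _ atR }

  admissible⁺ : ∀ {t} → Admissible t → T (admissibleᵇ t)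
  admissible⁺ adm =
    T-∧⁺ (≤⇒≤ᵇ (1≤start adm)) (T-∧⁺ (≤⇒≤ᵇ (start<end adm)) (T-∧⁺ (≤⇒≤ᵇ (end≤m adm))
      (T-∧⁺ (subst (T ∘ isL) (sym (startL adm)) tt) (subst (T ∘ isR) (sym (endR adm)) tt))))

  starts-before-ends : ∀ {s t} → Admissible s → Admissible t → lu s < lv t
  starts-before-ends s t = SS-L<R _ _ (startL s) (endR t)

  admissible-exchange : ∀ {u₁ v₁ u₂ v₂ a b} → Admissible (u₁ , v₁ , a) → Admissible (u₂ , v₂ , b) →
                        Admissible (u₁ , v₂ , a)
  admissible-exchange s t = record
    { 1≤start = 1≤start s ; start<end = starts-before-ends s t ; end≤m = end≤m t
    ; startL = startL s ; endR = endR t }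

  admissible-overlap : ∀ {s t} → Admissible s → Admissible t → lu s ≢ lu t → lv s ≢ lv t → Overlap s t
  admissible-overlap s t starts≢ ends≢ = record
    { starts≢ = starts≢ ; ends≢ = ends≢ ; s<t = starts-before-ends s t ; t<s = starts-before-ends t s }

  candidateᵇ : List LInt → Bool
  candidateᵇ ι = isIntervalSetᵇ λ′ (rank λ′) ι ∧ positiveLabelsᵇ ι ∧ repeatedLabelᵇ ι ∧ monomialIsᵇ β ι

  record Candidate (ι : List LInt) : Set where
    field
      size       : length ι ≡ rank λ′
      increasing : T (increasingᵇ (map lu ι))
      distinct   : Unique (map lu ι ++ map lv ι)
      admissible : All Admissible ι
      labelled   : All (λ t → 1 ≤ lab t × lab t ≤ length β) ι
      repeated   : T (repeatedLabelᵇ ι)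
      monomial   : All (λ c → exponent ι c ≡ row β c) (oneTo (length β))

  candidate⁻ : ∀ ι → T (candidateᵇ ι) → Candidate ι
  candidate⁻ ι h =
    let intervalSet , h₁  = T-∧⁻ h
        positive , h₂     = T-∧⁻ h₁
        repeated , mon    = T-∧⁻ h₂
        size , h₃         = T-∧⁻ intervalSet
        increasing , h₄   = T-∧⁻ h₃
        distinct , adm    = T-∧⁻ h₄
        exponents , bound = T-∧⁻ mon
    in record
      { size       = ≡ᵇ⇒≡ (length ι) _ size
      ; increasing = increasing
      ; distinct   = distinctᵇ⇒Unique _ distinct
      ; admissible = All.map (admissible⁻ _) (All.all⁺ admissibleᵇ ι adm)
      ; labelled   = All.zipWith (λ (1≤c , c≤N) → ≤ᵇ⇒≤ 1 _ 1≤c , ≤ᵇ⇒≤ _ _ c≤N)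
                       (All.all⁺ _ ι positive , All.all⁺ _ ι bound)
      ; repeated   = repeated
      ; monomial   = All.map (≡ᵇ⇒≡ _ _) (All.all⁺ _ _ exponents) }

  candidate⁺ : ∀ {ι} → Candidate ι → T (candidateᵇ ι)
  candidate⁺ {ι} c = T-∧⁺ intervalSet (T-∧⁺ positive (T-∧⁺ repeated monomialᵇ))
    where
    open Candidate c
    intervalSet : T (isIntervalSetᵇ λ′ (rank λ′) ι)
    intervalSet = T-∧⁺ (≡⇒≡ᵇ _ _ size) (T-∧⁺ increasing (T-∧⁺ (Unique⇒distinctᵇ distinct)
                    (All.all⁻ admissibleᵇ (All.map admissible⁺ admissible))))
    positive : T (positiveLabelsᵇ ι)
    positive = All.all⁻ _ (All.map (≤⇒≤ᵇ ∘ proj₁) labelled)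
    monomialᵇ : T (monomialIsᵇ β ι)
    monomialᵇ = T-∧⁺ (All.all⁻ _ (All.map (λ {c} → ≡⇒≡ᵇ _ _) monomial))
                     (All.all⁻ _ (All.map (≤⇒≤ᵇ ∘ proj₂) labelled))

  private
    Unique-∷∷ : ∀ {a b : ℕ} {cs} → Unique (a ∷ b ∷ cs) → a ≢ b × All (a ≢_) cs × All (b ≢_) cs
    Unique-∷∷ ((a≢b ∷ a∉cs) ∷ (b∉cs ∷ _)) = a≢b , a∉cs , b∉cs

  module _ {ι ι′ : List LInt} (e : Exchanged ι ι′) (c : Candidate ι) where

    open Exchanged e
    open Candidate c

    private
      admissible-xy : All Admissible (x ∷ y ∷ rest)
      admissible-xy = All-resp-↭ (before-↭ e) admissible

      adm-x : Admissible x
      adm-x = All.head admissible-xy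

      adm-y : Admissible y
      adm-y = All.head (All.tail admissible-xy)

      adm-rest : All Admissible rest
      adm-rest = All.tail (All.tail admissible-xy)

      starts : map lu ι′ ≡ map lu ι
      starts = map-exchanged e lu refl

      labels-kept : ∀ {P : ℕ → Set} → All (P ∘ lab) (x ∷ y ∷ rest) → All (P ∘ lab) (x′ ∷ y′ ∷ rest)
      labels-kept (px ∷ py ∷ prest) = px ∷ py ∷ prest

    candidate-exchanged : Candidate ι′
    candidate-exchanged = record
      { size       = trans (trans (sym (length-map lu ι′)) (cong length starts)) (trans (length-map lu ι) size)
      ; increasing = subst (T ∘ increasingᵇ) (sym starts) increasing
      ; distinct   = Unique-↭ (↭-sym (↭-++⁺ (↭-reflexive starts) (ends-↭ e))) distinct
      ; admissible = All-resp-↭ (↭-sym (after-↭ e))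
                       (admissible-exchange adm-x adm-y ∷ admissible-exchange adm-y adm-x ∷ adm-rest)
      ; labelled   = All-resp-↭ (↭-sym (after-↭ e)) (labels-kept (All-resp-↭ (before-↭ e) labelled))
      ; repeated   = subst (T ∘ not ∘ distinctᵇ) (sym (map-exchanged e lab refl)) repeated
      ; monomial   = All.map (λ {b} → trans (exponent-exchanged e
                       (<⇒≤ (start<end adm-x)) (<⇒≤ (start<end adm-y))
                       (<⇒≤ (starts-before-ends adm-x adm-y)) (<⇒≤ (starts-before-ends adm-y adm-x)) b))
                       monomial }

    sign-exchanged : sign (crossing ι′) ≡ - sign (crossing ι)
    sign-exchanged = sign-flip (crossing ι) (crossing ι′)
      (crossing-exchanged e (admissible-overlap adm-x adm-y u₁≢u₂ v₁≢v₂) (start<end adm-x) (start<end adm-y)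
        (All.tabulate λ z∈ →
            admissible-overlap adm-x (All.lookup adm-rest z∈) (All.lookup u₁∉ z∈) (All.lookup v₁∉ z∈)
          , admissible-overlap adm-y (All.lookup adm-rest z∈) (All.lookup u₂∉ z∈) (All.lookup v₂∉ z∈)))
      where
      starts! = Unique-∷∷ (Unique-↭ (↭-map⁺ lu (before-↭ e)) (proj₁ (Unique-++⁻ (map lu ι) distinct)))
      ends!   = Unique-∷∷ (Unique-↭ (↭-map⁺ lv (before-↭ e)) (proj₂ (Unique-++⁻ (map lu ι) distinct)))
      u₁≢u₂   = proj₁ starts!
      u₁∉     = All.map⁻ (proj₁ (proj₂ starts!))
      u₂∉     = All.map⁻ (proj₂ (proj₂ starts!))
      v₁≢v₂   = proj₁ ends!
      v₁∉     = All.map⁻ (proj₁ (proj₂ ends!))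
      v₂∉     = All.map⁻ (proj₂ (proj₂ ends!))

  enumeration : List (List LInt)
  enumeration = listsOfLength (rank λ′) (triples (length (SS λ′)) (length β))

  candidates : List (List LInt)
  candidates = filterᵇ candidateᵇ enumeration

  candidates-unique : Unique candidates
  candidates-unique =
    Unique.filter⁺ (T? ∘ candidateᵇ) (listsOfLength-unique _ (triples-unique (length (SS λ′)) (length β)) (rank λ′))

  ∈-candidates⁻ : ∀ {ι} → ι ∈ candidates → Candidate ι
  ∈-candidates⁻ {ι} ι∈ = candidate⁻ ι (proj₂ (∈-filter⁻ (T? ∘ candidateᵇ) {xs = enumeration} ι∈))

  ∈-candidates⁺ : ∀ {ι} → Candidate ι → ι ∈ candidates
  ∈-candidates⁺ {ι} c = ∈-filter⁺ (T? ∘ candidateᵇ) (subst (λ k → ι ∈ listsOfLength k _) size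
    (∈-listsOfLength⁺ _ (All.zipWith (λ (adm , 1≤a , a≤N) →
       ∈-triples⁺ (∈-oneTo⁺ (1≤start adm) (≤-trans (<⇒≤ (start<end adm)) (end≤m adm)))
                  (∈-oneTo⁺ (≤-trans (1≤start adm) (<⇒≤ (start<end adm))) (end≤m adm))
                  (∈-oneTo⁺ 1≤a a≤N)) (admissible , labelled)))) (candidate⁺ c)
    where open Candidate c

  switch-candidate : ∀ {ι} → Candidate ι → Candidate (switch ι)
  switch-candidate {ι} c = candidate-exchanged (switch-exchanged ι (Candidate.repeated c)) c

  sign-switch : ∀ {ι} → Candidate ι → sign (crossing (switch ι)) ≡ - sign (crossing ι)
  sign-switch {ι} c = sign-exchanged (switch-exchanged ι (Candidate.repeated c)) c

lemma7p2 : (λ′ : List ℕ) → IsPartition λ′ → (β : List ℕ) → coeffRepeated λ′ β ≡ 0ℤ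
lemma7p2 λ′ partition β =
  sumℤ-signReversing≡0 switch switch-involutive (∈-candidates⁺ ∘ switch-candidate ∘ ∈-candidates⁻)
    candidates-unique (sign ∘ crossing) (sign-switch ∘ ∈-candidates⁻)
  where open Candidates partition β
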